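{- Every complete Girard algebra $\mathbf A$ (i.e. one whose lattice reduct is a complete lattice) is the Girard-algebra reduct of a girale; in particular it embeds into a girale.
   Context: A commutative residuated lattice is $\langle A,\vee,\wedge,\to,\cdot,1\rangle$ with $\langle A,\vee,\wedge\rangle$ a lattice, $\langle A,\cdot,1\rangle$ a commutative monoid, and $x\cdot y\le z$ iff $x\le y\to z$. A Girard algebra is a commutative residuated lattice with a constant $0$ with $(b\to 0)\to 0=b$ for all $b$; $\neg x:=x\to 0$. A girale is a Girard algebra with a unary operation $!$ satisfying (G1) $!1=1$; (G2) $!a\le a\wedge 1$; (G3) $!a\cdot !b=!(a\wedge b)$; (G4) $!!a=!a$. -}

module Defs where

open import Level using (Level; suc)
open import Data.Product using (Σ; _×_; _,_)
open import Relation.Binary.PropositionalEquality using (_≡_)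

record CommResLattice (c : Level) : Set (suc c) where
  infixr 5 _⇒_
  infixl 7 _·_
  infixr 6 _∨_
  infixr 6 _∧_
  infix 4 _≤_
  field
    Carrier : Set c
    _∨_ _∧_ _⇒_ _·_ : Carrier → Carrier → Carrier
    1#        : Carrier
    ∨-comm    : ∀ x y → x ∨ y ≡ y ∨ x
    ∧-comm    : ∀ x y → x ∧ y ≡ y ∧ x
    ∨-assoc   : ∀ x y z → (x ∨ y) ∨ z ≡ x ∨ (y ∨ z)
    ∧-assoc   : ∀ x y z → (x ∧ y) ∧ z ≡ x ∧ (y ∧ z)
    ∨-absorbs-∧ : ∀ x y → x ∨ (x ∧ y) ≡ x
    ∧-absorbs-∨ : ∀ x y → x ∧ (x ∨ y) ≡ x
    ·-assoc   : ∀ x y z → (x · y) · z ≡ x · (y · z)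
    ·-comm    : ∀ x y → x · y ≡ y · x
    ·-identityˡ : ∀ x → 1# · x ≡ x

  _≤_ : Carrier → Carrier → Set c
  x ≤ y = x ∧ y ≡ x

  field
    residuate   : ∀ x y z → x · y ≤ z → x ≤ y ⇒ z
    unresiduate : ∀ x y z → x ≤ y ⇒ z → x · y ≤ z

record GirardAlgebra (c : Level) : Set (suc c) where
  field
    crl : CommResLattice c
  open CommResLattice crl public
  field
    0#          : Carrier
    double-neg  : ∀ b → (b ⇒ 0#) ⇒ 0# ≡ b

  ¬_ : Carrier → Carrier
  ¬ x = x ⇒ 0#

IsComplete : ∀ {c} → GirardAlgebra c → Set (suc c)
IsComplete {c} A =
  (S : Carrier → Set c) →
  Σ Carrier λ s → ((x : Carrier) → S x → x ≤ s)
                × ((u : Carrier) → ((x : Carrier) → S x → x ≤ u) → s ≤ u)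
  where open GirardAlgebra A

IsGiraleOp : ∀ {c} (A : GirardAlgebra c) → (GirardAlgebra.Carrier A → GirardAlgebra.Carrier A) → Set c
IsGiraleOp A ! =
    (! 1# ≡ 1#)
  × (∀ a → ! a ≤ a ∧ 1#)
  × (∀ a b → ! a · ! b ≡ ! (a ∧ b))
  × (∀ a → ! (! a) ≡ ! a)
  where open GirardAlgebra A

-- Put ! a = 1 when 1 ≤ a and ! a = ⊥ otherwise.  Constructively this is the join
-- of the set {x | x ≡ 1 and 1 ≤ a}, which exists by completeness without deciding
-- 1 ≤ a, and is characterised by: 1 ≤ a implies 1 ≤ ! a, and ! a ≤ u whenever
-- 1 ≤ a implies 1 ≤ u.  Each of (G1)–(G4) follows from this characterisation,
-- using residuation for ! a · ! b ≤ ! (a ∧ b).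
module Submission where

open import Defs
open import Level using (Level)
open import Data.Product using (Σ; _×_; _,_; proj₁; proj₂)
open import Function using (id)
open import Relation.Binary.PropositionalEquality

module CommResLatticeOrder {c : Level} (L : CommResLattice c) where
  open CommResLattice L

  ≤-refl : ∀ x → x ≤ x
  ≤-refl x = begin
    x ∧ x            ≡⟨ cong (x ∧_) (sym (∨-absorbs-∧ x x)) ⟩
    x ∧ (x ∨ x ∧ x)  ≡⟨ ∧-absorbs-∨ x (x ∧ x) ⟩
    x                ∎
    where open ≡-Reasoning

  ≤-trans : ∀ {x y z} → x ≤ y → y ≤ z → x ≤ z
  ≤-trans {x} {y} {z} x≤y y≤z = begin
    x ∧ z        ≡⟨ cong (_∧ z) (sym x≤y) ⟩
    (x ∧ y) ∧ z  ≡⟨ ∧-assoc x y z ⟩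
    x ∧ (y ∧ z)  ≡⟨ cong (x ∧_) y≤z ⟩
    x ∧ y        ≡⟨ x≤y ⟩
    x            ∎
    where open ≡-Reasoning

  ≤-antisym : ∀ {x y} → x ≤ y → y ≤ x → x ≡ y
  ≤-antisym {x} {y} x≤y y≤x = trans (sym x≤y) (trans (∧-comm x y) y≤x)

  ∧-greatest : ∀ {x a b} → x ≤ a → x ≤ b → x ≤ a ∧ b
  ∧-greatest {x} {a} {b} x≤a x≤b =
    trans (sym (∧-assoc x a b)) (trans (cong (_∧ b) x≤a) x≤b)

  x∧y≤x : ∀ x y → x ∧ y ≤ x
  x∧y≤x x y = begin
    (x ∧ y) ∧ x  ≡⟨ ∧-assoc x y x ⟩
    x ∧ (y ∧ x)  ≡⟨ cong (x ∧_) (∧-comm y x) ⟩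
    x ∧ (x ∧ y)  ≡⟨ sym (∧-assoc x x y) ⟩
    (x ∧ x) ∧ y  ≡⟨ cong (_∧ y) (≤-refl x) ⟩
    x ∧ y        ∎
    where open ≡-Reasoning

  x∧y≤y : ∀ x y → x ∧ y ≤ y
  x∧y≤y x y = subst (_≤ y) (∧-comm y x) (x∧y≤x y x)

  ·-monoˡ-≤ : ∀ {x y} z → x ≤ y → x · z ≤ y · z
  ·-monoˡ-≤ {x} {y} z x≤y =
    unresiduate x z (y · z) (≤-trans x≤y (residuate y z (y · z) (≤-refl (y · z))))

  ·-mono-≤ : ∀ {x x′ y y′} → x ≤ x′ → y ≤ y′ → x · y ≤ x′ · y′
  ·-mono-≤ {x} {x′} {y} {y′} x≤x′ y≤y′ = ≤-trans (·-monoˡ-≤ y x≤x′)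
    (subst₂ _≤_ (·-comm y x′) (·-comm y′ x′) (·-monoˡ-≤ x′ y≤y′))

module CompleteGirale {c : Level} (A : GirardAlgebra c) (complete : IsComplete A) where
  open GirardAlgebra A
  open CommResLatticeOrder crl

  private
    Unit-if-above-1 : Carrier → Carrier → Set c
    Unit-if-above-1 a x = (x ≡ 1#) × (1# ≤ a)

  ! : Carrier → Carrier
  ! a = proj₁ (complete (Unit-if-above-1 a))

  !-upper : ∀ {a} → 1# ≤ a → 1# ≤ ! a
  !-upper {a} 1≤a = proj₁ (proj₂ (complete (Unit-if-above-1 a))) 1# (refl , 1≤a)

  !-least : ∀ a u → (1# ≤ a → 1# ≤ u) → ! a ≤ u
  !-least a u 1≤u = proj₂ (proj₂ (complete (Unit-if-above-1 a))) u
    λ { x (refl , 1≤a) → 1≤u 1≤a }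

  !-deflationary : ∀ a → ! a ≤ a ∧ 1#
  !-deflationary a = !-least a (a ∧ 1#) λ 1≤a → ∧-greatest 1≤a (≤-refl 1#)

  !-unit : ! 1# ≡ 1#
  !-unit = ≤-antisym (≤-trans (!-deflationary 1#) (x∧y≤y 1# 1#)) (!-upper (≤-refl 1#))

  !-·-≡-∧ : ∀ a b → ! a · ! b ≡ ! (a ∧ b)
  !-·-≡-∧ a b = ≤-antisym !a·!b≤!a∧b !a∧b≤!a·!b
    where
    !a·!b≤!a∧b : ! a · ! b ≤ ! (a ∧ b)
    !a·!b≤!a∧b = unresiduate (! a) (! b) (! (a ∧ b))
      (!-least a (! b ⇒ ! (a ∧ b)) λ 1≤a →
        residuate 1# (! b) (! (a ∧ b))
          (subst (_≤ ! (a ∧ b)) (sym (·-identityˡ (! b)))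
            (!-least b (! (a ∧ b)) λ 1≤b → !-upper (∧-greatest 1≤a 1≤b))))

    !a∧b≤!a·!b : ! (a ∧ b) ≤ ! a · ! b
    !a∧b≤!a·!b = !-least (a ∧ b) (! a · ! b) λ 1≤a∧b →
      subst (_≤ ! a · ! b) (·-identityˡ 1#)
        (·-mono-≤ (!-upper (≤-trans 1≤a∧b (x∧y≤x a b)))
                  (!-upper (≤-trans 1≤a∧b (x∧y≤y a b))))

  !-idempotent : ∀ a → ! (! a) ≡ ! a
  !-idempotent a = ≤-antisym (!-least (! a) (! a) id)
                             (!-least a (! (! a)) λ 1≤a → !-upper (!-upper 1≤a))

  !-isGiraleOp : IsGiraleOp A !
  !-isGiraleOp = !-unit , !-deflationary , !-·-≡-∧ , !-idempotent

mainTheorem11 : ∀ {c : Level} (A : GirardAlgebra c) → IsComplete A →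
    Σ (GirardAlgebra.Carrier A → GirardAlgebra.Carrier A) (IsGiraleOp A)
mainTheorem11 A complete = ! , !-isGiraleOp
  where open CompleteGirale A complete
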